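{- The free product $\mathbb{Z}_2*\mathbb{Z}_2*\mathbb{Z}_2$ is freely telescopic.
   Context: For a group $G$ and $H\le G$, $N_G(H)=\{g\in G: gHg^{ -1}=H\}$. A group $T$ is freely telescopic if for every finite group $\Gamma$ there exists a finite-index free subgroup $H\le T$ with $N_T(H)/H\cong\Gamma$. -}

module Defs where

open import Level using (0ℓ)
open import Data.Bool using (Bool; true; false; not; _∧_; T; if_then_else_)
open import Data.Bool.Properties using (T-∧)
open import Relation.Nullary.Decidable using (⌊_⌋)
open import Data.Unit using (⊤; tt)
open import Data.Empty using (⊥)
open import Data.Nat using (ℕ)
open import Data.Fin using (Fin; _≟_)
open import Data.List using (List; []; _∷_; foldl; foldr)
open import Data.Product using (Σ; _×_; _,_; ∃; proj₂)
open import Relation.Nullary using (¬_; yes; no)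
open import Relation.Binary.PropositionalEquality using (_≡_; _≢_)
import Relation.Binary.PropositionalEquality as ≡
open import Algebra.Bundles using (Group)
open import Function.Bundles using (Inverse; Equivalence)

-- The group Z₂ * Z₂ * Z₂, modelled by its normal forms:
-- reduced words in three involutive generators 0,1,2 (no two
-- consecutive letters equal).

Word : Set
Word = List (Fin 3)

eqᵇ : Fin 3 → Fin 3 → Bool
eqᵇ a b = ⌊ a ≟ b ⌋

-- reducedFrom a w : the word a ∷ w is reduced
reducedFrom : Fin 3 → Word → Bool
reducedFrom a [] = true
reducedFrom a (b ∷ w) = not (eqᵇ a b) ∧ reducedFrom b w

reducedᵇ : Word → Bool
reducedᵇ [] = true
reducedᵇ (a ∷ w) = reducedFrom a w

push : Fin 3 → Word → Word
push a [] = a ∷ []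
push a (b ∷ w) = if eqᵇ a b then w else a ∷ b ∷ w

private
  red-tail : ∀ b w → T (reducedFrom b w) → T (reducedᵇ w)
  red-tail b [] r = tt
  red-tail b (c ∷ w) r = proj₂ (T-∧ .Equivalence.to r)

  push-red-aux : ∀ a b w (d : Bool) → eqᵇ a b ≡ d → T (reducedFrom b w) →
                 T (reducedᵇ (if d then w else a ∷ b ∷ w))
  push-red-aux a b w true  eq r = red-tail b w r
  push-red-aux a b w false eq r rewrite eq = r

  push-red : ∀ a w → T (reducedᵇ w) → T (reducedᵇ (push a w))
  push-red a [] r = tt
  push-red a (b ∷ w) r = push-red-aux a b w (eqᵇ a b) ≡.refl r

record G : Set where
  constructor ⟨_,_⟩
  field
    word    : Word
    reduced : T (reducedᵇ word)

pushG : Fin 3 → G → G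
pushG a ⟨ w , r ⟩ = ⟨ push a w , push-red a w r ⟩

e : G
e = ⟨ [] , tt ⟩

infixl 7 _·_
_·_ : G → G → G
⟨ w , _ ⟩ · y = foldr pushG y w

-- inverse: the reversed word (computed by pushing letters onto e)
infix 8 _⁻¹
_⁻¹ : G → G
⟨ w , _ ⟩ ⁻¹ = foldl (λ acc a → pushG a acc) e w

module Notions (A : Set) (_∙_ : A → A → A) (ε : A) (inv : A → A) where

  record IsSubgroup (H : A → Set) : Set where
    field
      ε∈   : H ε
      ∙∈   : ∀ {x y} → H x → H y → H (x ∙ y)
      inv∈ : ∀ {x} → H x → H (inv x)

  FiniteIndex : (A → Set) → Set
  FiniteIndex H = Σ ℕ λ n → Σ (Fin n → A) λ r →
    ∀ x → ∃ λ i → H (inv (r i) ∙ x)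

  SWord : Set → Set
  SWord I = List (I × Bool)   -- (i , true) = b i , (i , false) = (b i)⁻¹

  evalW : {I : Set} → (I → A) → SWord I → A
  evalW b = foldr (λ { (i , true) acc → b i ∙ acc ; (i , false) acc → inv (b i) ∙ acc }) ε

  ReducedW : {I : Set} → SWord I → Set
  ReducedW [] = ⊤
  ReducedW (_ ∷ []) = ⊤
  ReducedW ((i , s) ∷ (j , t) ∷ w) = ¬ (i ≡ j × s ≡ not t) × ReducedW ((j , t) ∷ w)

  IsFreeBasis : (H : A → Set) (I : Set) → (I → A) → Set
  IsFreeBasis H I b =
      (∀ i → H (b i))
    × (∀ h → H h → Σ (SWord I) λ w → evalW b w ≡ h)
    × (∀ w → ReducedW w → evalW b w ≡ ε → w ≡ [])

  IsFree : (A → Set) → Set₁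
  IsFree H = Σ Set λ I → Σ (I → A) λ b → IsFreeBasis H I b

  Normalizer : (A → Set) → A → Set
  Normalizer H g = ∀ x →
      ((Σ A λ h → H h × x ≡ (g ∙ h) ∙ inv g) → H x)
    × (H x → Σ A λ h → H h × x ≡ (g ∙ h) ∙ inv g)

  -- N_A(H)/H ≅ Γ : a map ψ defined on N = N_A(H) which is constant on
  -- cosets gH, injective on cosets, a homomorphism, and surjective; i.e.
  -- an isomorphism of groups from the quotient N/H (cosets xH, x ∈ N)
  -- onto Γ.
  QuotientIso : (H : A → Set) → Group 0ℓ 0ℓ → Set
  QuotientIso H Γ = Σ (A → Carrier) λ ψ →
      (∀ x y → N x → N y → H (inv x ∙ y) → ψ x ≈ ψ y)
    × (∀ x y → N x → N y → ψ x ≈ ψ y → H (inv x ∙ y))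
    × (∀ x y → N x → N y → ψ (x ∙ y) ≈ ψ x ∘ ψ y)
    × (∀ γ → Σ A λ x → N x × ψ x ≈ γ)
    where
      open Group Γ renaming (_∙_ to _∘_)
      N = Normalizer H

  IsFiniteGroup : Group 0ℓ 0ℓ → Set
  IsFiniteGroup Γ = Σ ℕ λ n → Inverse (≡.setoid (Fin n)) (Group.setoid Γ)

  FreelyTelescopic : Set₁
  FreelyTelescopic = (Γ : Group 0ℓ 0ℓ) → IsFiniteGroup Γ →
    Σ (A → Set) λ H →
      IsSubgroup H × FiniteIndex H × IsFree H × QuotientIso H Γ

Z₂*Z₂*Z₂-FreelyTelescopic : Set₁
Z₂*Z₂*Z₂-FreelyTelescopic = Notions.FreelyTelescopic G _·_ e _⁻¹

-- Let Z₂*Z₂*Z₂ act on a finite set V by three involutions σ₀, σ₁, σ₂ (an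
-- action of the free product is exactly this) and let H = Stab(v₀).  Then
--   • H has finite index (orbit–stabiliser),
--   • H is free (Schreier): choosing a spanning tree of the Schreier graph, H
--     is freely generated by the non-tree edges.  Freeness is proved with the
--     signature of a path, a cocycle with values in the free group on the
--     edges: a reduced word in the basis has itself as signature, hence is ≠ e;
--   • g normalises H iff g v₀ is fixed by H.
-- Given a finite group K = {0,…,m}, we build V as |K| copies of a gadget whose
-- colour-2 edges link copy δ to copy k·δ.  K acts on the right on the copies,
-- commuting with the action, and two explicit elements of H show that the only
-- H-fixed points are the base points of the copies.  Hence N(H)/H ≅ K.

module Submission where

open import Defs
open import Level using (0ℓ)
open import Data.Bool using (Bool; true; false; not; T; _∧_; if_then_else_)
import Data.Bool.Properties as Bool
open import Data.Unit using (⊤; tt)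
open import Data.Empty using (⊥-elim)
open import Data.Nat using (ℕ; zero; suc)
import Data.Nat.Properties as ℕ
open import Data.Fin using (Fin; zero; suc; _≟_; inject₁; fromℕ; toℕ)
import Data.Fin.Properties as Fin
open import Data.Maybe using (Maybe; just; nothing)
import Data.Maybe as Maybe
open import Data.List using (List; []; _∷_; foldl; foldr; map; _++_; length; lookup; allFin; cartesianProduct)
open import Data.List.Membership.Propositional using (_∈_)
open import Data.List.Relation.Unary.Any using (here; there; index)
open import Data.List.Membership.Propositional.Properties
  using (∈-map⁺; ∈-++⁺ˡ; ∈-++⁺ʳ; ∈-allFin; ∈-cartesianProduct⁺)
open import Data.List.Relation.Unary.Any.Properties using (lookup-index)
open import Data.Product using (Σ; _×_; _,_; proj₁; proj₂)
open import Data.Product.Properties using (≡-dec)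
open import Data.Sum using (_⊎_; inj₁; inj₂)
import Data.Sum.Properties as Sum
open import Relation.Nullary using (Dec; yes; no; does)
open import Relation.Nullary.Decidable using (dec-true; dec-false; via-injection)
open import Relation.Binary.Definitions using (DecidableEquality)
open import Relation.Binary.PropositionalEquality
open import Algebra.Bundles using (Group)
import Algebra.Properties.Group as GroupProperties
open import Algebra.Structures using (IsGroup)
open import Function.Bundles using (Equivalence; Inverse; mk↣)

open Notions G _·_ e _⁻¹

G-≡ : ∀ {x y : G} → G.word x ≡ G.word y → x ≡ y
G-≡ {⟨ w , r ⟩} {⟨ .w , r′ ⟩} refl = cong ⟨ w ,_⟩ (Bool.T-irrelevant r r′)

reducedᵇ-tail : ∀ a w → T (reducedFrom a w) → T (reducedᵇ w)
reducedᵇ-tail a [] r = tt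
reducedᵇ-tail a (b ∷ w) r = proj₂ (Equivalence.to Bool.T-∧ r)

push-self : ∀ a w → push a (a ∷ w) ≡ w
push-self a w with a ≟ a
... | yes _ = refl
... | no a≢a = ⊥-elim (a≢a refl)

push-fresh : ∀ a w → T (reducedFrom a w) → push a w ≡ a ∷ w
push-fresh a [] r = refl
push-fresh a (b ∷ w) r with a ≟ b
... | no _ = refl

push-involutive : ∀ a w → T (reducedᵇ w) → push a (push a w) ≡ w
push-involutive a [] r = push-self a []
push-involutive a (b ∷ w) r with a ≟ b
... | yes refl = push-fresh a w r
... | no _ = push-self a (b ∷ w)

pushG-involutive : ∀ a x → pushG a (pushG a x) ≡ x
pushG-involutive a ⟨ w , r ⟩ = G-≡ (push-involutive a w r)

-- The generator a; note that gen a · x reduces to pushG a x.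
gen : Fin 3 → G
gen a = pushG a e

pushG-· : ∀ a x y → pushG a x · y ≡ pushG a (x · y)
pushG-· a ⟨ [] , r ⟩ y = refl
pushG-· a ⟨ b ∷ w , r ⟩ y with a ≟ b
... | yes refl = sym (pushG-involutive a _)
... | no _ = refl

·-assoc : ∀ x y z → (x · y) · z ≡ x · (y · z)
·-assoc ⟨ w , _ ⟩ y z = foldr-· w
  where
    foldr-· : ∀ w → foldr pushG y w · z ≡ foldr pushG (y · z) w
    foldr-· [] = refl
    foldr-· (a ∷ w) = trans (pushG-· a (foldr pushG y w) z) (cong (pushG a) (foldr-· w))

·-identityʳ : ∀ x → x · e ≡ x
·-identityʳ ⟨ w , r ⟩ = foldr-e w r
  where
    foldr-e : ∀ w (r : T (reducedᵇ w)) → foldr pushG e w ≡ ⟨ w , r ⟩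
    foldr-e [] tt = refl
    foldr-e (a ∷ w) r = trans (cong (pushG a) (foldr-e w (reducedᵇ-tail a w r)))
                              (G-≡ (push-fresh a w r))

cons-pushG : ∀ a w (r : T (reducedFrom a w)) →
             ⟨ a ∷ w , r ⟩ ≡ pushG a ⟨ w , reducedᵇ-tail a w r ⟩
cons-pushG a w r = G-≡ (sym (push-fresh a w r))

cons-⁻¹ : ∀ a w (r : T (reducedFrom a w)) →
          ⟨ a ∷ w , r ⟩ ⁻¹ ≡ ⟨ w , reducedᵇ-tail a w r ⟩ ⁻¹ · gen a
cons-⁻¹ a w r = foldl-· w (gen a)
  where
    step : G → Fin 3 → G
    step acc b = pushG b acc
    foldl-· : ∀ w acc → foldl step acc w ≡ foldl step e w · acc
    foldl-· [] acc = refl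
    foldl-· (b ∷ w) acc = begin
      foldl step (pushG b acc) w        ≡⟨ foldl-· w (pushG b acc) ⟩
      foldl step e w · (gen b · acc)    ≡⟨ sym (·-assoc (foldl step e w) (gen b) acc) ⟩
      (foldl step e w · gen b) · acc    ≡⟨ cong (_· acc) (sym (foldl-· w (gen b))) ⟩
      foldl step (gen b) w · acc        ∎
      where open ≡-Reasoning

·-inverseˡ : ∀ x → x ⁻¹ · x ≡ e
·-inverseˡ ⟨ w , r ⟩ = word-inverseˡ w r
  where
    open ≡-Reasoning
    word-inverseˡ : ∀ w (r : T (reducedᵇ w)) → ⟨ w , r ⟩ ⁻¹ · ⟨ w , r ⟩ ≡ e
    word-inverseˡ [] tt = refl
    word-inverseˡ (a ∷ w) r = begin
      ⟨ a ∷ w , r ⟩ ⁻¹ · ⟨ a ∷ w , r ⟩  ≡⟨ cong₂ _·_ (cons-⁻¹ a w r) (cons-pushG a w r) ⟩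
      (x ⁻¹ · gen a) · pushG a x         ≡⟨ ·-assoc (x ⁻¹) (gen a) (pushG a x) ⟩
      x ⁻¹ · pushG a (pushG a x)         ≡⟨ cong (x ⁻¹ ·_) (pushG-involutive a x) ⟩
      x ⁻¹ · x                           ≡⟨ word-inverseˡ w (reducedᵇ-tail a w r) ⟩
      e                                  ∎
      where x = ⟨ w , reducedᵇ-tail a w r ⟩

·-inverseʳ : ∀ x → x · x ⁻¹ ≡ e
·-inverseʳ ⟨ w , r ⟩ = word-inverseʳ w r
  where
    open ≡-Reasoning
    word-inverseʳ : ∀ w (r : T (reducedᵇ w)) → ⟨ w , r ⟩ · ⟨ w , r ⟩ ⁻¹ ≡ e
    word-inverseʳ [] tt = refl
    word-inverseʳ (a ∷ w) r = begin
      ⟨ a ∷ w , r ⟩ · ⟨ a ∷ w , r ⟩ ⁻¹  ≡⟨ cong₂ _·_ (cons-pushG a w r) (cons-⁻¹ a w r) ⟩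
      pushG a x · (x ⁻¹ · gen a)         ≡⟨ pushG-· a x (x ⁻¹ · gen a) ⟩
      pushG a (x · (x ⁻¹ · gen a))       ≡⟨ cong (pushG a) (sym (·-assoc x (x ⁻¹) (gen a))) ⟩
      pushG a ((x · x ⁻¹) · gen a)       ≡⟨ cong (λ y → pushG a (y · gen a)) (word-inverseʳ w (reducedᵇ-tail a w r)) ⟩
      pushG a (gen a)                    ≡⟨ pushG-involutive a e ⟩
      e                                  ∎
      where x = ⟨ w , reducedᵇ-tail a w r ⟩

Z₂*Z₂*Z₂ : Group 0ℓ 0ℓ
Z₂*Z₂*Z₂ = record
  { Carrier = G ; _≈_ = _≡_ ; _∙_ = _·_ ; ε = e ; _⁻¹ = _⁻¹
  ; isGroup = record
    { isMonoid = record
      { isSemigroup = record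
        { isMagma = record { isEquivalence = isEquivalence ; ∙-cong = cong₂ _·_ }
        ; assoc = ·-assoc }
      ; identity = (λ _ → refl) , ·-identityʳ }
    ; inverse = ·-inverseˡ , ·-inverseʳ
    ; ⁻¹-cong = cong _⁻¹ } }

open GroupProperties Z₂*Z₂*Z₂ using (⁻¹-involutive; ⁻¹-anti-homo-∙; \\-leftDividesˡ)

module FreeGroup {E : Set} (_≟E_ : DecidableEquality E) where

  -- (x , true) stands for x, (x , false) for x⁻¹
  Letter : Set
  Letter = E × Bool

  _≟L_ : DecidableEquality Letter
  _≟L_ = ≡-dec _≟E_ Bool._≟_

  flip : Letter → Letter
  flip (x , s) = (x , not s)

  flip-involutive : ∀ l → flip (flip l) ≡ l
  flip-involutive (x , s) = cong (x ,_) (Bool.not-involutive s)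

  FWord : Set
  FWord = List Letter

  Reduced : FWord → Set
  Reduced [] = ⊤
  Reduced (l ∷ []) = ⊤
  Reduced (l ∷ l′ ∷ L) = l′ ≢ flip l × Reduced (l′ ∷ L)

  reduced-tail : ∀ l L → Reduced (l ∷ L) → Reduced L
  reduced-tail l [] r = tt
  reduced-tail l (l′ ∷ L) r = proj₂ r

  infixr 5 _◁_ _⊕_

  _◁_ : Letter → FWord → FWord
  l ◁ [] = l ∷ []
  l ◁ (l′ ∷ L) with l′ ≟L flip l
  ... | yes _ = L
  ... | no _ = l ∷ l′ ∷ L

  ◁-reduced : ∀ l L → Reduced L → Reduced (l ◁ L)
  ◁-reduced l [] r = tt
  ◁-reduced l (l′ ∷ L) r with l′ ≟L flip l
  ... | yes _ = reduced-tail l′ L r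
  ... | no l′≢l⁻¹ = l′≢l⁻¹ , r

  ◁-fresh : ∀ l L → Reduced (l ∷ L) → l ◁ L ≡ l ∷ L
  ◁-fresh l [] r = refl
  ◁-fresh l (l′ ∷ L) r with l′ ≟L flip l
  ... | yes l′≡l⁻¹ = ⊥-elim (proj₁ r l′≡l⁻¹)
  ... | no _ = refl

  ◁-cancel : ∀ l L → Reduced L → flip l ◁ l ◁ L ≡ L
  ◁-cancel l [] r with l ≟L flip (flip l)
  ... | yes _ = refl
  ... | no l≢l = ⊥-elim (l≢l (sym (flip-involutive l)))
  ◁-cancel l (l′ ∷ L) r with l′ ≟L flip l
  ... | yes refl = ◁-fresh (flip l) L r
  ... | no _ with l ≟L flip (flip l)
  ...   | yes _ = refl
  ...   | no l≢l = ⊥-elim (l≢l (sym (flip-involutive l)))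

  ◁-cancel′ : ∀ l L → Reduced L → l ◁ flip l ◁ L ≡ L
  ◁-cancel′ l L r = subst (λ l″ → l″ ◁ flip l ◁ L ≡ L) (flip-involutive l) (◁-cancel (flip l) L r)

  -- the product of the free group (the left factor need not be reduced)
  _⊕_ : FWord → FWord → FWord
  L ⊕ M = foldr _◁_ M L

  ⊕-reduced : ∀ L M → Reduced M → Reduced (L ⊕ M)
  ⊕-reduced [] M r = r
  ⊕-reduced (l ∷ L) M r = ◁-reduced l (L ⊕ M) (⊕-reduced L M r)

  ◁-⊕ : ∀ l L M → Reduced M → (l ◁ L) ⊕ M ≡ l ◁ L ⊕ M
  ◁-⊕ l [] M r = refl
  ◁-⊕ l (l′ ∷ L) M r with l′ ≟L flip l
  ... | yes refl = sym (◁-cancel′ l (L ⊕ M) (⊕-reduced L M r))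
  ... | no _ = refl

  ⊕-assoc : ∀ L M N → Reduced N → (L ⊕ M) ⊕ N ≡ L ⊕ M ⊕ N
  ⊕-assoc [] M N r = refl
  ⊕-assoc (l ∷ L) M N r = trans (◁-⊕ l (L ⊕ M) N r) (cong (l ◁_) (⊕-assoc L M N r))

  ⊕-identityʳ : ∀ L → Reduced L → L ⊕ [] ≡ L
  ⊕-identityʳ [] r = refl
  ⊕-identityʳ (l ∷ L) r =
    trans (cong (l ◁_) (⊕-identityʳ L (reduced-tail l L r))) (◁-fresh l L r)

  inverse : FWord → FWord
  inverse [] = []
  inverse (l ∷ L) = inverse L ⊕ flip l ∷ []

  inverse-reduced : ∀ L → Reduced (inverse L)
  inverse-reduced [] = tt
  inverse-reduced (l ∷ L) = ⊕-reduced (inverse L) (flip l ∷ []) tt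

  ⊕-inverseʳ : ∀ L → L ⊕ inverse L ≡ []
  ⊕-inverseʳ [] = refl
  ⊕-inverseʳ (l ∷ L) = begin
    l ◁ L ⊕ (inverse L ⊕ flip l ∷ [])  ≡⟨ cong (l ◁_) (sym (⊕-assoc L (inverse L) (flip l ∷ []) tt)) ⟩
    l ◁ (L ⊕ inverse L) ⊕ flip l ∷ []  ≡⟨ cong (λ M → l ◁ M ⊕ flip l ∷ []) (⊕-inverseʳ L) ⟩
    l ◁ flip l ◁ []                     ≡⟨ ◁-cancel′ l [] tt ⟩
    []                                  ∎
    where open ≡-Reasoning

  inverse-unique : ∀ L M → Reduced L → L ⊕ M ≡ [] → L ≡ inverse M
  inverse-unique L M r L⊕M≡[] = begin
    L                        ≡⟨ sym (⊕-identityʳ L r) ⟩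
    L ⊕ []                   ≡⟨ cong (L ⊕_) (sym (⊕-inverseʳ M)) ⟩
    L ⊕ M ⊕ inverse M        ≡⟨ sym (⊕-assoc L M (inverse M) (inverse-reduced M)) ⟩
    (L ⊕ M) ⊕ inverse M      ≡⟨ cong (_⊕ inverse M) L⊕M≡[] ⟩
    inverse M                ∎
    where open ≡-Reasoning

conjugation-closed⇒normalizer : (H : G → Set) (g : G) →
  (∀ h → H h → H ((g · h) · g ⁻¹)) → (∀ h → H h → H ((g ⁻¹ · h) · g)) →
  Normalizer H g
conjugation-closed⇒normalizer H g conj conj⁻¹ x =
  (λ { (h , h∈H , refl) → conj h h∈H }) ,
  (λ x∈H → (g ⁻¹ · x) · g , conj⁻¹ x x∈H , sym (unconjugate x))
  where
    open ≡-Reasoning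
    unconjugate : ∀ x → (g · ((g ⁻¹ · x) · g)) · g ⁻¹ ≡ x
    unconjugate x = begin
      (g · ((g ⁻¹ · x) · g)) · g ⁻¹   ≡⟨ cong (_· g ⁻¹) (sym (·-assoc g (g ⁻¹ · x) g)) ⟩
      ((g · (g ⁻¹ · x)) · g) · g ⁻¹   ≡⟨ ·-assoc (g · (g ⁻¹ · x)) g (g ⁻¹) ⟩
      (g · (g ⁻¹ · x)) · (g · g ⁻¹)   ≡⟨ cong₂ _·_ (sym (·-assoc g (g ⁻¹) x)) (·-inverseʳ g) ⟩
      ((g · g ⁻¹) · x) · e            ≡⟨ cong (λ y → (y · x) · e) (·-inverseʳ g) ⟩
      x · e                           ≡⟨ ·-identityʳ x ⟩
      x                               ∎

module Action {V : Set} (σ : Fin 3 → V → V) (σ-involutive : ∀ a v → σ a (σ a v) ≡ v) where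

  actWord : Word → V → V
  actWord w v = foldr σ v w

  act : G → V → V
  act x = actWord (G.word x)

  act-pushG : ∀ a x v → act (pushG a x) v ≡ σ a (act x v)
  act-pushG a ⟨ [] , _ ⟩ v = refl
  act-pushG a ⟨ b ∷ w , _ ⟩ v with a ≟ b
  ... | yes refl = sym (σ-involutive a (actWord w v))
  ... | no _ = refl

  act-foldr : ∀ w y v → act (foldr pushG y w) v ≡ actWord w (act y v)
  act-foldr [] y v = refl
  act-foldr (a ∷ w) y v = trans (act-pushG a (foldr pushG y w) v) (cong (σ a) (act-foldr w y v))

  act-· : ∀ x y v → act (x · y) v ≡ act x (act y v)
  act-· ⟨ w , _ ⟩ = act-foldr w

  act-inverseˡ : ∀ x v → act (x ⁻¹) (act x v) ≡ v
  act-inverseˡ x v = trans (sym (act-· (x ⁻¹) x v)) (cong (λ y → act y v) (·-inverseˡ x))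

  act-inverseʳ : ∀ x v → act x (act (x ⁻¹) v) ≡ v
  act-inverseʳ x v = trans (sym (act-· x (x ⁻¹) v)) (cong (λ y → act y v) (·-inverseʳ x))

  Equivariant : (V → V) → Set
  Equivariant ρ = ∀ x v → act x (ρ v) ≡ ρ (act x v)

  module Stabilizer (v₀ : V) where

    Stab : G → Set
    Stab g = act g v₀ ≡ v₀

    stab-subgroup : IsSubgroup Stab
    stab-subgroup = record
      { ε∈ = refl
      ; ∙∈ = λ {x} {y} x∈ y∈ → trans (act-· x y v₀) (trans (cong (act x) y∈) x∈)
      ; inv∈ = λ {x} x∈ → trans (cong (act (x ⁻¹)) (sym x∈)) (act-inverseˡ x v₀) }

    same-coset⇒ : ∀ x y → Stab (x ⁻¹ · y) → act x v₀ ≡ act y v₀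
    same-coset⇒ x y x⁻¹y∈ = begin
      act x v₀                     ≡⟨ cong (act x) (sym x⁻¹y∈) ⟩
      act x (act (x ⁻¹ · y) v₀)    ≡⟨ cong (act x) (act-· (x ⁻¹) y v₀) ⟩
      act x (act (x ⁻¹) (act y v₀)) ≡⟨ act-inverseʳ x (act y v₀) ⟩
      act y v₀                     ∎
      where open ≡-Reasoning

    same-coset⇐ : ∀ x y → act x v₀ ≡ act y v₀ → Stab (x ⁻¹ · y)
    same-coset⇐ x y xv₀≡yv₀ = begin
      act (x ⁻¹ · y) v₀            ≡⟨ act-· (x ⁻¹) y v₀ ⟩
      act (x ⁻¹) (act y v₀)        ≡⟨ cong (act (x ⁻¹)) (sym xv₀≡yv₀) ⟩
      act (x ⁻¹) (act x v₀)        ≡⟨ act-inverseˡ x v₀ ⟩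
      v₀                           ∎
      where open ≡-Reasoning

    finite-index : (t : V → G) → (∀ u → act (t u) v₀ ≡ u) →
                   (vs : List V) → (∀ v → v ∈ vs) → FiniteIndex Stab
    finite-index t t-act vs enum =
      length vs , (λ i → t (lookup vs i)) ,
      λ x → index (enum (act x v₀)) ,
            same-coset⇐ (t _) x (trans (t-act _) (sym (lookup-index (enum (act x v₀)))))

    normalizer⇒fixed : ∀ g → Normalizer Stab g → ∀ h → Stab h → act h (act g v₀) ≡ act g v₀
    normalizer⇒fixed g g∈N h h∈ with proj₂ (g∈N h) h∈
    ... | (h′ , h′∈ , refl) = begin
      act ((g · h′) · g ⁻¹) (act g v₀)     ≡⟨ act-· (g · h′) (g ⁻¹) (act g v₀) ⟩
      act (g · h′) (act (g ⁻¹) (act g v₀)) ≡⟨ cong (act (g · h′)) (act-inverseˡ g v₀) ⟩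
      act (g · h′) v₀                      ≡⟨ act-· g h′ v₀ ⟩
      act g (act h′ v₀)                    ≡⟨ cong (act g) h′∈ ⟩
      act g v₀                             ∎
      where open ≡-Reasoning

    equivariant⇒normalizer : ∀ g (ρ ρ′ : V → V) → Equivariant ρ → Equivariant ρ′ →
                             ρ′ (ρ v₀) ≡ v₀ → act g v₀ ≡ ρ v₀ → Normalizer Stab g
    equivariant⇒normalizer g ρ ρ′ ρ-eq ρ′-eq ρ′ρ gv₀ =
      conjugation-closed⇒normalizer Stab g conj conj⁻¹
      where
        open ≡-Reasoning
        g⁻¹v₀ : act (g ⁻¹) v₀ ≡ ρ′ v₀
        g⁻¹v₀ = begin
          act (g ⁻¹) v₀              ≡⟨ cong (act (g ⁻¹)) (sym (trans (ρ′-eq g v₀) (trans (cong ρ′ gv₀) ρ′ρ))) ⟩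
          act (g ⁻¹) (act g (ρ′ v₀)) ≡⟨ act-inverseˡ g (ρ′ v₀) ⟩
          ρ′ v₀                      ∎
        conj : ∀ h → Stab h → Stab ((g · h) · g ⁻¹)
        conj h h∈ = begin
          act ((g · h) · g ⁻¹) v₀       ≡⟨ act-· (g · h) (g ⁻¹) v₀ ⟩
          act (g · h) (act (g ⁻¹) v₀)   ≡⟨ act-· g h _ ⟩
          act g (act h (act (g ⁻¹) v₀)) ≡⟨ cong (λ v → act g (act h v)) g⁻¹v₀ ⟩
          act g (act h (ρ′ v₀))         ≡⟨ cong (act g) (trans (ρ′-eq h v₀) (cong ρ′ h∈)) ⟩
          act g (ρ′ v₀)                 ≡⟨ cong (act g) (sym g⁻¹v₀) ⟩
          act g (act (g ⁻¹) v₀)         ≡⟨ act-inverseʳ g v₀ ⟩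
          v₀                            ∎
        conj⁻¹ : ∀ h → Stab h → Stab ((g ⁻¹ · h) · g)
        conj⁻¹ h h∈ = begin
          act ((g ⁻¹ · h) · g) v₀       ≡⟨ act-· (g ⁻¹ · h) g v₀ ⟩
          act (g ⁻¹ · h) (act g v₀)     ≡⟨ act-· (g ⁻¹) h _ ⟩
          act (g ⁻¹) (act h (act g v₀)) ≡⟨ cong (λ v → act (g ⁻¹) (act h v)) gv₀ ⟩
          act (g ⁻¹) (act h (ρ v₀))     ≡⟨ cong (act (g ⁻¹)) (trans (ρ-eq h v₀) (cong ρ h∈)) ⟩
          act (g ⁻¹) (ρ v₀)             ≡⟨ cong (act (g ⁻¹)) (sym gv₀) ⟩
          act (g ⁻¹) (act g v₀)         ≡⟨ act-inverseˡ g v₀ ⟩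
          v₀                            ∎

_≟e : (x : G) → Dec (x ≡ e)
⟨ [] , tt ⟩ ≟e = yes refl
⟨ _ ∷ _ , _ ⟩ ≟e = no (λ ())

evalW-++ : ∀ {I : Set} (b : I → G) W₁ W₂ → evalW b (W₁ ++ W₂) ≡ evalW b W₁ · evalW b W₂
evalW-++ b [] W₂ = refl
evalW-++ b ((i , true) ∷ W₁) W₂ = trans (cong (b i ·_) (evalW-++ b W₁ W₂)) (sym (·-assoc (b i) _ _))
evalW-++ b ((i , false) ∷ W₁) W₂ = trans (cong (b i ⁻¹ ·_) (evalW-++ b W₁ W₂)) (sym (·-assoc (b i ⁻¹) _ _))

reducedW-tail : ∀ {I : Set} (l : I × Bool) W → ReducedW (l ∷ W) → ReducedW W
reducedW-tail l [] _ = tt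
reducedW-tail l (_ ∷ _) r = proj₂ r

-- The
-- orientation ori names each edge {u, σ a u} by one endpoint (ori-flip forces
-- σ a u ≠ u), and t : V → G is a transversal (t u sends v₀ to u).
module Schreier {V : Set} (_≟V_ : DecidableEquality V)
                (σ : Fin 3 → V → V) (σ-involutive : ∀ a v → σ a (σ a v) ≡ v)
                (ori : V → Fin 3 → Bool) (ori-flip : ∀ u a → ori (σ a u) a ≡ not (ori u a))
                (v₀ : V) (t : V → G) where

  open Action σ σ-involutive
  open Stabilizer v₀
  open FreeGroup {V × Fin 3} (≡-dec _≟V_ _≟_)

  edge : V → Fin 3 → G
  edge u a = t (σ a u) ⁻¹ · (gen a · t u)

  edge-flip : ∀ u a → edge (σ a u) a ≡ edge u a ⁻¹
  edge-flip u a = begin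
    t (σ a (σ a u)) ⁻¹ · (gen a · t (σ a u))   ≡⟨ cong (λ v → t v ⁻¹ · (gen a · t (σ a u))) (σ-involutive a u) ⟩
    t u ⁻¹ · (gen a · t (σ a u))               ≡⟨ sym (·-assoc (t u ⁻¹) (gen a) (t (σ a u))) ⟩
    (t u ⁻¹ · gen a) · t (σ a u)               ≡⟨ cong₂ _·_ (sym (⁻¹-anti-homo-∙ (gen a) (t u))) (sym (⁻¹-involutive (t (σ a u)))) ⟩
    (gen a · t u) ⁻¹ · t (σ a u) ⁻¹ ⁻¹         ≡⟨ sym (⁻¹-anti-homo-∙ (t (σ a u) ⁻¹) (gen a · t u)) ⟩
    edge u a ⁻¹                                ∎
    where open ≡-Reasoning

  edge-trivial-flip : ∀ u a → edge u a ≡ e → edge (σ a u) a ≡ e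
  edge-trivial-flip u a trivial = trans (edge-flip u a) (cong _⁻¹ trivial)

  edge-trivial-unflip : ∀ u a → edge (σ a u) a ≡ e → edge u a ≡ e
  edge-trivial-unflip u a trivial =
    subst (λ v → edge v a ≡ e) (σ-involutive a u) (edge-trivial-flip (σ a u) a trivial)

  -- The letter of the free group recording a traversal of u —a→ σ a u: the
  -- edge is named by its positively oriented endpoint.
  letter : V → Fin 3 → Letter
  letter u a = if ori u a then ((u , a) , true) else ((σ a u , a) , false)

  letter-flip : ∀ u a → letter (σ a u) a ≡ flip (letter u a)
  letter-flip u a rewrite ori-flip u a with ori u a
  ... | true = cong (λ v → ((v , a) , false)) (σ-involutive a u)
  ... | false = refl

  -- Record one step along u —a→ σ a u; edges with trivial generator (tree
  -- edges) are invisible.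
  step : Fin 3 → V → FWord → FWord
  step a u L with edge u a ≟e
  ... | yes _ = L
  ... | no _ = letter u a ◁ L

  step-tree : ∀ a u L → edge u a ≡ e → step a u L ≡ L
  step-tree a u L trivial with edge u a ≟e
  ... | yes _ = refl
  ... | no nontrivial = ⊥-elim (nontrivial trivial)

  step-nontree : ∀ a u L → edge u a ≢ e → step a u L ≡ letter u a ◁ L
  step-nontree a u L nontrivial with edge u a ≟e
  ... | yes trivial = ⊥-elim (nontrivial trivial)
  ... | no _ = refl

  step-reduced : ∀ a u L → Reduced L → Reduced (step a u L)
  step-reduced a u L r with edge u a ≟e
  ... | yes _ = r
  ... | no _ = ◁-reduced (letter u a) L r

  -- stepping back along the same edge undoes the step, so that signatures are
  -- compatible with the cancellation a·a = 1
  step-cancel : ∀ a u L → Reduced L → step a (σ a u) (step a u L) ≡ L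
  step-cancel a u L r with edge u a ≟e | edge (σ a u) a ≟e
  ... | yes _ | yes _ = refl
  ... | yes trivial | no nontrivial = ⊥-elim (nontrivial (edge-trivial-flip u a trivial))
  ... | no nontrivial | yes trivial = ⊥-elim (nontrivial (edge-trivial-unflip u a trivial))
  ... | no _ | no _ =
    trans (cong (_◁ letter u a ◁ L) (letter-flip u a)) (◁-cancel (letter u a) L r)

  step-⊕ : ∀ a u L M → Reduced M → step a u (L ⊕ M) ≡ step a u L ⊕ M
  step-⊕ a u L M r with edge u a ≟e
  ... | yes _ = refl
  ... | no _ = sym (◁-⊕ (letter u a) L M r)

  -- The signature of x at v: the reduced word of non-tree edges crossed by the
  -- path from v spelled by x (read from the right).
  signatureWord : Word → V → FWord
  signatureWord [] v = []
  signatureWord (a ∷ w) v = step a (actWord w v) (signatureWord w v)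

  signature : G → V → FWord
  signature x = signatureWord (G.word x)

  signature-reduced : ∀ x v → Reduced (signature x v)
  signature-reduced ⟨ w , _ ⟩ v = go w
    where
      go : ∀ w → Reduced (signatureWord w v)
      go [] = tt
      go (a ∷ w) = step-reduced a (actWord w v) (signatureWord w v) (go w)

  signature-pushG : ∀ a x v → signature (pushG a x) v ≡ step a (act x v) (signature x v)
  signature-pushG a ⟨ [] , _ ⟩ v = refl
  signature-pushG a ⟨ b ∷ w , r ⟩ v with a ≟ b
  ... | yes refl = sym (step-cancel a (actWord w v) (signatureWord w v)
                          (signature-reduced ⟨ w , reducedᵇ-tail a w r ⟩ v))
  ... | no _ = refl

  signature-· : ∀ x y v → signature (x · y) v ≡ signature x (act y v) ⊕ signature y v
  signature-· ⟨ w , _ ⟩ y v = go w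
    where
      go : ∀ w → signature (foldr pushG y w) v ≡ signatureWord w (act y v) ⊕ signature y v
      go [] = refl
      go (a ∷ w) = begin
        signature (pushG a (foldr pushG y w)) v
          ≡⟨ signature-pushG a (foldr pushG y w) v ⟩
        step a (act (foldr pushG y w) v) (signature (foldr pushG y w) v)
          ≡⟨ cong₂ (step a) (act-foldr w y v) (go w) ⟩
        step a (actWord w (act y v)) (signatureWord w (act y v) ⊕ signature y v)
          ≡⟨ step-⊕ a _ (signatureWord w (act y v)) _ (signature-reduced y v) ⟩
        signatureWord (a ∷ w) (act y v) ⊕ signature y v ∎
        where open ≡-Reasoning

  signature-⁻¹ : ∀ x v → signature (x ⁻¹) (act x v) ≡ inverse (signature x v)
  signature-⁻¹ x v = inverse-unique _ _ (signature-reduced (x ⁻¹) (act x v))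
    (trans (sym (signature-· (x ⁻¹) x v)) (cong (λ y → signature y v) (·-inverseˡ x)))

  -- x spells a path from v to u using tree edges only.
  record TreePath (x : G) (v u : V) : Set where
    constructor treePath
    field
      reaches : act x v ≡ u
      silent  : signature x v ≡ []
  open TreePath public

  tree-edge : ∀ u a → t (σ a u) ≡ gen a · t u → edge u a ≡ e
  tree-edge u a t-σ = trans (cong (λ y → y ⁻¹ · (gen a · t u)) t-σ) (·-inverseˡ (gen a · t u))

  tree-path-step : ∀ {x v u} a → TreePath x v u → edge u a ≡ e → TreePath (pushG a x) v (σ a u)
  tree-path-step {x} {v} {u} a (treePath x-act x-sig) trivial = treePath
    (trans (act-pushG a x v) (cong (σ a) x-act))
    (trans (signature-pushG a x v) (trans (cong₂ (step a) x-act x-sig) (step-tree a u [] trivial)))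

  tree-path-· : ∀ {x y w v u} → TreePath x v u → TreePath y w v → TreePath (x · y) w u
  tree-path-· {x} {y} {w} (treePath x-act x-sig) (treePath y-act y-sig) = treePath
    (trans (act-· x y w) (trans (cong (act x) y-act) x-act))
    (trans (signature-· x y w) (cong₂ _⊕_ (trans (cong (signature x) y-act) x-sig) y-sig))

  tree-path-⁻¹ : ∀ {x v u} → TreePath x v u → TreePath (x ⁻¹) u v
  tree-path-⁻¹ {x} {v} (treePath refl x-sig) = treePath
    (act-inverseˡ x v) (trans (signature-⁻¹ x v) (cong inverse x-sig))

  isBasisEdge : V → Fin 3 → Bool
  isBasisEdge u a = not (does (edge u a ≟e)) ∧ ori u a

  BasisEdge : Set
  BasisEdge = Σ (V × Fin 3) λ ua → T (isBasisEdge (proj₁ ua) (proj₂ ua))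

  basis : BasisEdge → G
  basis ((u , a) , _) = edge u a

  basis-edge : ∀ u a → edge u a ≢ e → ori u a ≡ true → T (isBasisEdge u a)
  basis-edge u a nontrivial oriented
    rewrite dec-false (edge u a ≟e) nontrivial | oriented = tt

  basis-edge-nontrivial : ∀ u a → T (isBasisEdge u a) → edge u a ≢ e
  basis-edge-nontrivial u a basic trivial rewrite dec-true (edge u a ≟e) trivial = basic

  basis-edge-oriented : ∀ u a → T (isBasisEdge u a) → ori u a ≡ true
  basis-edge-oriented u a basic = Equivalence.to Bool.T-≡ (proj₂ (Equivalence.to Bool.T-∧ basic))

  edge-generated : ∀ u a → Σ (SWord BasisEdge) λ W → evalW basis W ≡ edge u a
  edge-generated u a with edge u a ≟e
  ... | yes trivial = [] , sym trivial
  ... | no nontrivial with ori u a in oriented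
  ...   | true = (((u , a) , basis-edge u a nontrivial oriented) , true) ∷ [] , ·-identityʳ (edge u a)
  ...   | false =
    (((σ a u , a) , basis-edge (σ a u) a nontrivial′ oriented′) , false) ∷ [] ,
    trans (·-identityʳ _) (trans (cong _⁻¹ (edge-flip u a)) (⁻¹-involutive (edge u a)))
    where
      nontrivial′ : edge (σ a u) a ≢ e
      nontrivial′ trivial = nontrivial (edge-trivial-unflip u a trivial)
      oriented′ : ori (σ a u) a ≡ true
      oriented′ = trans (ori-flip u a) (cong not oriented)

  -- Schreier rewriting: t(x u)⁻¹ · x · t(u) is a product of generators, as
  -- t(a x u)⁻¹ · a x · t(u) = edge (x u) a · (t(x u)⁻¹ · x · t(u)).
  rewriting : ∀ x u → Σ (SWord BasisEdge) λ W → evalW basis W ≡ t (act x u) ⁻¹ · (x · t u)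
  rewriting ⟨ w , r ⟩ u = go w r
    where
      cancel-middle : ∀ p q s z → (p · (q · s)) · (s ⁻¹ · z) ≡ p · (q · z)
      cancel-middle p q s z = begin
        (p · (q · s)) · (s ⁻¹ · z)   ≡⟨ ·-assoc p (q · s) (s ⁻¹ · z) ⟩
        p · ((q · s) · (s ⁻¹ · z))   ≡⟨ cong (p ·_) (·-assoc q s (s ⁻¹ · z)) ⟩
        p · (q · (s · (s ⁻¹ · z)))   ≡⟨ cong (λ y → p · (q · y)) (sym (·-assoc s (s ⁻¹) z)) ⟩
        p · (q · ((s · s ⁻¹) · z))   ≡⟨ cong (λ y → p · (q · (y · z))) (·-inverseʳ s) ⟩
        p · (q · z)                  ∎
        where open ≡-Reasoning
      go : ∀ w (r : T (reducedᵇ w)) →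
           Σ (SWord BasisEdge) λ W → evalW basis W ≡ t (act ⟨ w , r ⟩ u) ⁻¹ · (⟨ w , r ⟩ · t u)
      go [] r = [] , sym (·-inverseˡ (t u))
      go (a ∷ w) r with edge-generated (actWord w u) a | go w (reducedᵇ-tail a w r)
      ... | (W₁ , W₁≡) | (W₂ , W₂≡) = W₁ ++ W₂ ,
        trans (evalW-++ basis W₁ W₂) (trans (cong₂ _·_ W₁≡ W₂≡)
          (cancel-middle (t (σ a (actWord w u)) ⁻¹) (gen a) (t (actWord w u)) (foldr pushG (t u) w)))

  forget : BasisEdge × Bool → Letter
  forget ((ua , _) , s) = (ua , s)

  forget-reduced : ∀ W → ReducedW W → Reduced (map forget W)
  forget-reduced [] _ = tt
  forget-reduced (_ ∷ []) _ = tt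
  forget-reduced (((ua , p) , s) ∷ ((ub , q) , s′) ∷ W) (not-inverse , r) =
    (λ { refl → not-inverse (cong (ua ,_) (Bool.T-irrelevant p q) , sym (Bool.not-involutive s)) }) ,
    forget-reduced (((ub , q) , s′) ∷ W) r

  letterValue : BasisEdge × Bool → G
  letterValue (i , true) = basis i
  letterValue (i , false) = basis i ⁻¹

  evalW-∷ : ∀ l W → evalW basis (l ∷ W) ≡ letterValue l · evalW basis W
  evalW-∷ (i , true) W = refl
  evalW-∷ (i , false) W = refl

  -- With a spanning tree, the basis is free: the signature at v₀ of a reduced
  -- word in the basis is that same word, so it cannot evaluate to e.
  module _ (spanning : ∀ u → TreePath (t u) v₀ u) where

    gen-t : ∀ u a → act (gen a · t u) v₀ ≡ σ a u
    gen-t u a = trans (act-pushG a (t u) v₀) (cong (σ a) (reaches (spanning u)))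

    edge-stabilizes : ∀ u a → Stab (edge u a)
    edge-stabilizes u a =
      trans (act-· (t (σ a u) ⁻¹) (gen a · t u) v₀)
            (trans (cong (act (t (σ a u) ⁻¹)) (gen-t u a)) (reaches (tree-path-⁻¹ (spanning (σ a u)))))

    signature-basis : ∀ u a → T (isBasisEdge u a) → signature (edge u a) v₀ ≡ ((u , a) , true) ∷ []
    signature-basis u a basic = begin
      signature (edge u a) v₀
        ≡⟨ signature-· (t (σ a u) ⁻¹) (gen a · t u) v₀ ⟩
      signature (t (σ a u) ⁻¹) (act (gen a · t u) v₀) ⊕ signature (gen a · t u) v₀
        ≡⟨ cong₂ _⊕_ (trans (cong (signature (t (σ a u) ⁻¹)) (gen-t u a))
                            (silent (tree-path-⁻¹ (spanning (σ a u)))))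
                     (signature-pushG a (t u) v₀) ⟩
      step a (act (t u) v₀) (signature (t u) v₀)
        ≡⟨ cong₂ (step a) (reaches (spanning u)) (silent (spanning u)) ⟩
      step a u []
        ≡⟨ step-nontree a u [] (basis-edge-nontrivial u a basic) ⟩
      letter u a ∷ []
        ≡⟨ cong (λ o → (if o then ((u , a) , true) else ((σ a u , a) , false)) ∷ [])
                (basis-edge-oriented u a basic) ⟩
      ((u , a) , true) ∷ [] ∎
      where open ≡-Reasoning

    letterValue-stabilizes : ∀ l → Stab (letterValue l)
    letterValue-stabilizes (((u , a) , _) , true) = edge-stabilizes u a
    letterValue-stabilizes (((u , a) , _) , false) = inv∈ {edge u a} (edge-stabilizes u a)
      where open IsSubgroup stab-subgroup

    signature-letterValue : ∀ l → signature (letterValue l) v₀ ≡ forget l ∷ []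
    signature-letterValue (((u , a) , basic) , true) = signature-basis u a basic
    signature-letterValue (((u , a) , basic) , false) =
      trans (cong (signature (edge u a ⁻¹)) (sym (edge-stabilizes u a)))
            (trans (signature-⁻¹ (edge u a) v₀) (cong inverse (signature-basis u a basic)))

    signature-evalW : ∀ W → ReducedW W →
                      Stab (evalW basis W) × signature (evalW basis W) v₀ ≡ map forget W
    signature-evalW [] _ = refl , refl
    signature-evalW (l ∷ W) r with signature-evalW W (reducedW-tail l W r)
    ... | (W-stab , W-sig) rewrite evalW-∷ l W =
      ∙∈ {letterValue l} {evalW basis W} (letterValue-stabilizes l) W-stab ,
      (begin
        signature (letterValue l · evalW basis W) v₀
          ≡⟨ signature-· (letterValue l) (evalW basis W) v₀ ⟩
        signature (letterValue l) (act (evalW basis W) v₀) ⊕ signature (evalW basis W) v₀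
          ≡⟨ cong₂ _⊕_ (trans (cong (signature (letterValue l)) W-stab) (signature-letterValue l)) W-sig ⟩
        forget l ◁ map forget W
          ≡⟨ ◁-fresh (forget l) (map forget W) (forget-reduced (l ∷ W) r) ⟩
        forget l ∷ map forget W ∎)
      where
        open IsSubgroup stab-subgroup
        open ≡-Reasoning

    stabilizer-free : t v₀ ≡ e → IsFree Stab
    stabilizer-free t-v₀ = BasisEdge , basis , (λ i → edge-stabilizes _ _) , generated , independent
      where
        generated : ∀ h → Stab h → Σ (SWord BasisEdge) λ W → evalW basis W ≡ h
        generated h h-stab with rewriting h v₀
        ... | (W , W≡) = W , (begin
          evalW basis W              ≡⟨ W≡ ⟩
          t (act h v₀) ⁻¹ · (h · t v₀) ≡⟨ cong (λ v → t v ⁻¹ · (h · t v₀)) h-stab ⟩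
          t v₀ ⁻¹ · (h · t v₀)       ≡⟨ cong (λ y → y ⁻¹ · (h · y)) t-v₀ ⟩
          h · e                      ≡⟨ ·-identityʳ h ⟩
          h                          ∎)
          where open ≡-Reasoning
        independent : ∀ W → ReducedW W → evalW basis W ≡ e → W ≡ []
        independent [] _ _ = refl
        independent (l ∷ W) r W≡e with trans (sym (proj₂ (signature-evalW (l ∷ W) r)))
                                            (cong (λ x → signature x v₀) W≡e)
        ... | ()

-- The chain 0 < 1 < … < m in Fin (suc m): partial successor and predecessor,
-- used to string the positions out k, in k of the gadget into one cycle.

-- k viewed in Fin m, unless k is the last element.
lower? : ∀ {m} → Fin (suc m) → Maybe (Fin m)
lower? {zero} zero = nothing
lower? {suc m} zero = just zero
lower? {suc m} (suc k) = Maybe.map suc (lower? k)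

lower?-inject₁ : ∀ {m} (k : Fin m) → lower? (inject₁ k) ≡ just k
lower?-inject₁ {suc m} zero = refl
lower?-inject₁ {suc m} (suc k) = cong (Maybe.map suc) (lower?-inject₁ k)

lower?-just : ∀ {m} (k : Fin (suc m)) {j} → lower? k ≡ just j → inject₁ j ≡ k
lower?-just {suc m} zero refl = refl
lower?-just {suc m} (suc k) eq with lower? k in lower-k
lower?-just {suc m} (suc k) refl | just j = cong suc (lower?-just k lower-k)

lower?-nothing : ∀ {m} (k : Fin (suc m)) → lower? k ≡ nothing → k ≡ fromℕ m
lower?-nothing {zero} zero _ = refl
lower?-nothing {suc m} (suc k) eq with lower? k in lower-k
... | nothing = cong suc (lower?-nothing k lower-k)

lower?-fromℕ : ∀ m → lower? (fromℕ m) ≡ nothing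
lower?-fromℕ zero = refl
lower?-fromℕ (suc m) = cong (Maybe.map suc) (lower?-fromℕ m)

next : ∀ {m} → Fin (suc m) → Maybe (Fin (suc m))
next k = Maybe.map suc (lower? k)

prev : ∀ {m} → Fin (suc m) → Maybe (Fin (suc m))
prev zero = nothing
prev (suc k) = just (inject₁ k)

prev⇒next : ∀ {m} (k : Fin (suc m)) {j} → prev k ≡ just j → next j ≡ just k
prev⇒next (suc k) refl = cong (Maybe.map suc) (lower?-inject₁ k)

next⇒prev : ∀ {m} (k : Fin (suc m)) {j} → next k ≡ just j → prev j ≡ just k
next⇒prev k eq with lower? k in lower-k
next⇒prev k refl | just j = cong just (lower?-just k lower-k)

next-nothing : ∀ {m} (k : Fin (suc m)) → next k ≡ nothing → k ≡ fromℕ m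
next-nothing k eq with lower? k in lower-k
... | nothing = lower?-nothing k lower-k

prev-nothing : ∀ {m} (k : Fin (suc m)) → prev k ≡ nothing → k ≡ zero
prev-nothing zero _ = refl

next-irreflexive : ∀ {m} (k : Fin (suc m)) → next k ≢ just k
next-irreflexive k eq with lower? k in lower-k
next-irreflexive k refl | just j = inject₁≢suc j (lower?-just (suc j) lower-k)
  where
    inject₁≢suc : ∀ {n} (j : Fin n) → inject₁ j ≢ suc j
    inject₁≢suc (suc j) eq = inject₁≢suc j (Fin.suc-injective eq)

prev-irreflexive : ∀ {m} (k : Fin (suc m)) → prev k ≢ just k
prev-irreflexive k eq = next-irreflexive k (prev⇒next k eq)

pattern c₀ = zero
pattern c₁ = suc zero
pattern c₂ = suc (suc zero)

-- Colours 0 and 1 form the double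
-- edge A = B and one long cycle
--   X –0– Z –1– Y –0– Z′ –1– out 0 –0– in 0 –1– out 1 – … – in m –1– X,
-- and colour 2 pairs A–X, B–Y, Z–Z′ and out k – in k (the latter across copies).
data Pos (K : Set) : Set where
  pA pB pX pY pZ pZ′ : Pos K
  pout pin : K → Pos K

module _ {K : Set} where

  encode : Pos K → Fin 6 ⊎ (Bool × K)
  encode pA = inj₁ zero
  encode pB = inj₁ (suc zero)
  encode pX = inj₁ (suc (suc zero))
  encode pY = inj₁ (suc (suc (suc zero)))
  encode pZ = inj₁ (suc (suc (suc (suc zero))))
  encode pZ′ = inj₁ (suc (suc (suc (suc (suc zero)))))
  encode (pout k) = inj₂ (true , k)
  encode (pin k) = inj₂ (false , k)

  decode : Fin 6 ⊎ (Bool × K) → Pos K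
  decode (inj₁ zero) = pA
  decode (inj₁ (suc zero)) = pB
  decode (inj₁ (suc (suc zero))) = pX
  decode (inj₁ (suc (suc (suc zero)))) = pY
  decode (inj₁ (suc (suc (suc (suc zero))))) = pZ
  decode (inj₁ (suc (suc (suc (suc (suc zero)))))) = pZ′
  decode (inj₂ (true , k)) = pout k
  decode (inj₂ (false , k)) = pin k

  decode-encode : ∀ p → decode (encode p) ≡ p
  decode-encode pA = refl
  decode-encode pB = refl
  decode-encode pX = refl
  decode-encode pY = refl
  decode-encode pZ = refl
  decode-encode pZ′ = refl
  decode-encode (pout k) = refl
  decode-encode (pin k) = refl

  _≟P_ : DecidableEquality K → DecidableEquality (Pos K)
  _≟P_ _≟K_ = via-injection (mk↣ encode-injective) (Sum.≡-dec _≟_ (≡-dec Bool._≟_ _≟K_))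
    where
      encode-injective : ∀ {p q} → encode p ≡ encode q → p ≡ q
      encode-injective {p} {q} eq =
        trans (sym (decode-encode p)) (trans (cong decode eq) (decode-encode q))

module Gadget (m : ℕ) {_⊙_ : Fin (suc m) → Fin (suc m) → Fin (suc m)} {one : Fin (suc m)}
              {invᴷ : Fin (suc m) → Fin (suc m)} (isGroup : IsGroup _≡_ _⊙_ one invᴷ) where

  open IsGroup isGroup using (assoc; identityˡ; identityʳ; inverseˡ; inverseʳ)

  K : Set
  K = Fin (suc m)

  V : Set
  V = K × Pos K

  _≟V_ : DecidableEquality V
  _≟V_ = ≡-dec _≟_ (_≟P_ _≟_)

  σpos : Fin 3 → Pos K → Pos K
  σpos c₀ pA = pB
  σpos c₀ pB = pA
  σpos c₀ pX = pZ
  σpos c₀ pZ = pX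
  σpos c₀ pY = pZ′
  σpos c₀ pZ′ = pY
  σpos c₀ (pout k) = pin k
  σpos c₀ (pin k) = pout k
  σpos c₁ pA = pB
  σpos c₁ pB = pA
  σpos c₁ pZ = pY
  σpos c₁ pY = pZ
  σpos c₁ pZ′ = pout zero
  σpos c₁ (pout k) = Maybe.maybe′ pin pZ′ (prev k)
  σpos c₁ (pin k) = Maybe.maybe′ pout pX (next k)
  σpos c₁ pX = pin (fromℕ m)
  σpos c₂ pA = pX
  σpos c₂ pX = pA
  σpos c₂ pB = pY
  σpos c₂ pY = pB
  σpos c₂ pZ = pZ′
  σpos c₂ pZ′ = pZ
  σpos c₂ (pout k) = pin k
  σpos c₂ (pin k) = pout k

  σpos-involutive : ∀ a p → σpos a (σpos a p) ≡ p
  σpos-involutive c₀ pA = refl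
  σpos-involutive c₀ pB = refl
  σpos-involutive c₀ pX = refl
  σpos-involutive c₀ pZ = refl
  σpos-involutive c₀ pY = refl
  σpos-involutive c₀ pZ′ = refl
  σpos-involutive c₀ (pout k) = refl
  σpos-involutive c₀ (pin k) = refl
  σpos-involutive c₁ pA = refl
  σpos-involutive c₁ pB = refl
  σpos-involutive c₁ pZ = refl
  σpos-involutive c₁ pY = refl
  σpos-involutive c₁ pZ′ = refl
  σpos-involutive c₁ (pout k) with prev k in prev-k
  ... | just j rewrite prev⇒next k prev-k = refl
  ... | nothing = cong pout (sym (prev-nothing k prev-k))
  σpos-involutive c₁ (pin k) with next k in next-k
  ... | just j rewrite next⇒prev k next-k = refl
  ... | nothing = cong pin (sym (next-nothing k next-k))
  σpos-involutive c₁ pX rewrite lower?-fromℕ m = refl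
  σpos-involutive c₂ pA = refl
  σpos-involutive c₂ pX = refl
  σpos-involutive c₂ pB = refl
  σpos-involutive c₂ pY = refl
  σpos-involutive c₂ pZ = refl
  σpos-involutive c₂ pZ′ = refl
  σpos-involutive c₂ (pout k) = refl
  σpos-involutive c₂ (pin k) = refl

  twist : Fin 3 → Pos K → K → K
  twist c₂ (pout k) δ = k ⊙ δ
  twist c₂ (pin k) δ = invᴷ k ⊙ δ
  twist _ _ δ = δ

  twist-involutive : ∀ a p δ → twist a (σpos a p) (twist a p δ) ≡ δ
  twist-involutive c₀ p δ = refl
  twist-involutive c₁ p δ = refl
  twist-involutive c₂ pA δ = refl
  twist-involutive c₂ pX δ = refl
  twist-involutive c₂ pB δ = refl
  twist-involutive c₂ pY δ = refl
  twist-involutive c₂ pZ δ = refl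
  twist-involutive c₂ pZ′ δ = refl
  twist-involutive c₂ (pout k) δ =
    trans (sym (assoc _ _ _)) (trans (cong (_⊙ δ) (inverseˡ k)) (identityˡ δ))
  twist-involutive c₂ (pin k) δ =
    trans (sym (assoc _ _ _)) (trans (cong (_⊙ δ) (inverseʳ k)) (identityˡ δ))

  σ : Fin 3 → V → V
  σ a (δ , p) = (twist a p δ , σpos a p)

  σ-involutive : ∀ a v → σ a (σ a v) ≡ v
  σ-involutive a (δ , p) = cong₂ _,_ (twist-involutive a p δ) (σpos-involutive a p)

  oriPos : Fin 3 → Pos K → Bool
  oriPos c₀ pA = true
  oriPos c₀ pX = true
  oriPos c₀ pY = true
  oriPos c₀ (pout _) = true
  oriPos c₁ pA = true
  oriPos c₁ pZ = true
  oriPos c₁ pZ′ = true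
  oriPos c₁ (pin _) = true
  oriPos c₂ pA = true
  oriPos c₂ pB = true
  oriPos c₂ pZ = true
  oriPos c₂ (pout _) = true
  oriPos _ _ = false

  oriPos-flip : ∀ a p → oriPos a (σpos a p) ≡ not (oriPos a p)
  oriPos-flip c₀ pA = refl
  oriPos-flip c₀ pB = refl
  oriPos-flip c₀ pX = refl
  oriPos-flip c₀ pZ = refl
  oriPos-flip c₀ pY = refl
  oriPos-flip c₀ pZ′ = refl
  oriPos-flip c₀ (pout k) = refl
  oriPos-flip c₀ (pin k) = refl
  oriPos-flip c₁ pA = refl
  oriPos-flip c₁ pB = refl
  oriPos-flip c₁ pZ = refl
  oriPos-flip c₁ pY = refl
  oriPos-flip c₁ pZ′ = refl
  oriPos-flip c₁ (pout k) with prev k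
  ... | just _ = refl
  ... | nothing = refl
  oriPos-flip c₁ (pin k) with next k
  ... | just _ = refl
  ... | nothing = refl
  oriPos-flip c₁ pX = refl
  oriPos-flip c₂ pA = refl
  oriPos-flip c₂ pX = refl
  oriPos-flip c₂ pB = refl
  oriPos-flip c₂ pY = refl
  oriPos-flip c₂ pZ = refl
  oriPos-flip c₂ pZ′ = refl
  oriPos-flip c₂ (pout k) = refl
  oriPos-flip c₂ (pin k) = refl

  ori : V → Fin 3 → Bool
  ori (δ , p) a = oriPos a p

  ori-flip : ∀ u a → ori (σ a u) a ≡ not (ori u a)
  ori-flip (δ , p) a = oriPos-flip a p

  v₀ : V
  v₀ = (one , pA)

  -- Spanning tree inside a copy: paths from A to every position, following
  -- A –2– X –0– Z –1– Y –0– Z′ –1– out 0 –0– in 0 –1– out 1 – …, and A –0– B.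
  pathZ′ : G
  pathZ′ = pushG c₀ (pushG c₁ (pushG c₀ (gen c₂)))

  pathOut : ℕ → G
  pathOut zero = pushG c₁ pathZ′
  pathOut (suc j) = pushG c₁ (pushG c₀ (pathOut j))

  path : Pos K → G
  path pA = e
  path pB = gen c₀
  path pX = gen c₂
  path pZ = pushG c₀ (gen c₂)
  path pY = pushG c₁ (pushG c₀ (gen c₂))
  path pZ′ = pathZ′
  path (pout k) = pathOut (toℕ k)
  path (pin k) = pushG c₀ (pathOut (toℕ k))

  bridgeWord : K → G
  bridgeWord δ = path (pin δ) ⁻¹ · (gen c₂ · path (pout δ))

  bridge : K → G
  bridge δ with δ ≟ one
  ... | yes _ = e
  ... | no _ = bridgeWord δ

  bridge-one : bridge one ≡ e
  bridge-one with one ≟ one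
  ... | yes _ = refl
  ... | no one≢one = ⊥-elim (one≢one refl)

  bridge-other : ∀ δ → δ ≢ one → bridge δ ≡ bridgeWord δ
  bridge-other δ δ≢one with δ ≟ one
  ... | yes δ≡one = ⊥-elim (δ≢one δ≡one)
  ... | no _ = refl

  t : V → G
  t (δ , p) = path p · bridge δ

  open Action σ σ-involutive public
  open Stabilizer v₀ public
  open Schreier _≟V_ σ σ-involutive ori ori-flip v₀ t

  copy-edge : ∀ δ q q′ a → σ a (δ , q) ≡ (δ , q′) → path q′ ≡ pushG a (path q) →
              TreePath (path q) (δ , pA) (δ , q) → TreePath (path q′) (δ , pA) (δ , q′)
  copy-edge δ q q′ a σ-edge path-edge to-q =
    subst₂ (λ x u → TreePath x (δ , pA) u) (sym path-edge) σ-edge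
           (tree-path-step a to-q (tree-edge (δ , q) a t-edge))
    where
      t-edge : t (σ a (δ , q)) ≡ gen a · t (δ , q)
      t-edge = begin
        t (σ a (δ , q))              ≡⟨ cong t σ-edge ⟩
        path q′ · bridge δ           ≡⟨ cong (_· bridge δ) path-edge ⟩
        pushG a (path q) · bridge δ  ≡⟨ pushG-· a (path q) (bridge δ) ⟩
        gen a · t (δ , q)            ∎
        where open ≡-Reasoning

  within-A : ∀ δ → TreePath (path pA) (δ , pA) (δ , pA)
  within-A δ = treePath refl refl

  within-X : ∀ δ → TreePath (path pX) (δ , pA) (δ , pX)
  within-X δ = copy-edge δ pA pX c₂ refl refl (within-A δ)

  within-Z : ∀ δ → TreePath (path pZ) (δ , pA) (δ , pZ)
  within-Z δ = copy-edge δ pX pZ c₀ refl refl (within-X δ)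

  within-Y : ∀ δ → TreePath (path pY) (δ , pA) (δ , pY)
  within-Y δ = copy-edge δ pZ pY c₁ refl refl (within-Z δ)

  within-Z′ : ∀ δ → TreePath (path pZ′) (δ , pA) (δ , pZ′)
  within-Z′ δ = copy-edge δ pY pZ′ c₀ refl refl (within-Y δ)

  within-out : ∀ δ j (k : K) → toℕ k ≡ j → TreePath (path (pout k)) (δ , pA) (δ , pout k)
  within-out δ zero zero refl = copy-edge δ pZ′ (pout zero) c₁ refl refl (within-Z′ δ)
  within-out δ (suc j) (suc k) k≡j =
    copy-edge δ (pin (inject₁ k)) (pout (suc k)) c₁
      (cong (λ n → (δ , Maybe.maybe′ pout pX n)) (prev⇒next (suc k) refl))
      (cong (λ n → pushG c₁ (pushG c₀ (pathOut n))) (sym (Fin.toℕ-inject₁ k)))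
      (copy-edge δ (pout (inject₁ k)) (pin (inject₁ k)) c₀ refl refl
        (within-out δ j (inject₁ k) (trans (Fin.toℕ-inject₁ k) (ℕ.suc-injective k≡j))))

  within-copy : ∀ δ q → TreePath (path q) (δ , pA) (δ , q)
  within-copy δ pA = within-A δ
  within-copy δ pB = copy-edge δ pA pB c₀ refl refl (within-A δ)
  within-copy δ pX = within-X δ
  within-copy δ pZ = within-Z δ
  within-copy δ pY = within-Y δ
  within-copy δ pZ′ = within-Z′ δ
  within-copy δ (pout k) = within-out δ (toℕ k) k refl
  within-copy δ (pin k) = copy-edge δ (pout k) (pin k) c₀ refl refl (within-out δ (toℕ k) k refl)

  -- The bridge crosses exactly one edge outside the copies, and it is a tree edge.
  bridge-path : ∀ δ → TreePath (bridge δ) v₀ (δ , pA)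
  bridge-path δ with δ ≟ one
  ... | yes refl = treePath refl refl
  ... | no δ≢one = tree-path-· (tree-path-⁻¹ (within-copy δ (pin δ))) crossing
    where
      cross-tree : edge (one , pout δ) c₂ ≡ e
      cross-tree = tree-edge (one , pout δ) c₂ (begin
        t (δ ⊙ one , pin δ)                               ≡⟨ cong (λ γ → t (γ , pin δ)) (identityʳ δ) ⟩
        path (pin δ) · bridge δ                           ≡⟨ cong (path (pin δ) ·_) (bridge-other δ δ≢one) ⟩
        path (pin δ) · (path (pin δ) ⁻¹ · (gen c₂ · path (pout δ)))
                                                          ≡⟨ \\-leftDividesˡ (path (pin δ)) _ ⟩
        gen c₂ · path (pout δ)                            ≡⟨ cong (gen c₂ ·_) (sym (·-identityʳ (path (pout δ)))) ⟩
        gen c₂ · (path (pout δ) · e)                      ≡⟨ cong (λ y → gen c₂ · (path (pout δ) · y)) (sym bridge-one) ⟩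
        gen c₂ · t (one , pout δ)                         ∎)
        where open ≡-Reasoning
      crossing : TreePath (gen c₂ · path (pout δ)) v₀ (δ , pin δ)
      crossing = subst (TreePath _ v₀) (cong (_, pin δ) (identityʳ δ))
                       (tree-path-step c₂ (within-copy one (pout δ)) cross-tree)

  spanning : ∀ u → TreePath (t u) v₀ u
  spanning (δ , p) = tree-path-· (within-copy δ p) (bridge-path δ)

  stab-free : IsFree Stab
  stab-free = stabilizer-free spanning bridge-one

  shift : K → V → V
  shift γ (δ , p) = (δ ⊙ γ , p)

  twist-shift : ∀ a p δ γ → twist a p (δ ⊙ γ) ≡ twist a p δ ⊙ γ
  twist-shift c₀ p δ γ = refl
  twist-shift c₁ p δ γ = refl
  twist-shift c₂ pA δ γ = refl
  twist-shift c₂ pB δ γ = refl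
  twist-shift c₂ pX δ γ = refl
  twist-shift c₂ pY δ γ = refl
  twist-shift c₂ pZ δ γ = refl
  twist-shift c₂ pZ′ δ γ = refl
  twist-shift c₂ (pout k) δ γ = sym (assoc k δ γ)
  twist-shift c₂ (pin k) δ γ = sym (assoc (invᴷ k) δ γ)

  shift-equivariant : ∀ γ → Equivariant (shift γ)
  shift-equivariant γ x = go (G.word x)
    where
      σ-shift : ∀ a v → σ a (shift γ v) ≡ shift γ (σ a v)
      σ-shift a (δ , p) = cong (_, σpos a p) (twist-shift a p δ γ)
      go : ∀ w v → actWord w (shift γ v) ≡ shift γ (actWord w v)
      go [] v = refl
      go (a ∷ w) v = trans (cong (σ a) (go w v)) (σ-shift a (actWord w v))

  shift-v₀ : ∀ δ → shift δ v₀ ≡ (δ , pA)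
  shift-v₀ δ = cong (_, pA) (identityˡ δ)

  at-A⇒normalizer : ∀ g δ → act g v₀ ≡ (δ , pA) → Normalizer Stab g
  at-A⇒normalizer g δ gv₀ =
    equivariant⇒normalizer g (shift δ) (shift (invᴷ δ))
      (shift-equivariant δ) (shift-equivariant (invᴷ δ)) unshift (trans gv₀ (sym (shift-v₀ δ)))
    where
      unshift : shift (invᴷ δ) (shift δ v₀) ≡ v₀
      unshift = cong (_, pA) (trans (assoc one δ (invᴷ δ))
                             (trans (cong (one ⊙_) (inverseʳ δ)) (identityˡ one)))

  -- Two elements of Stab: the first rotates the long cycle and fixes only A
  -- and B; the second fixes v₀ but moves every B.
  rotation separator : G
  rotation = ⟨ c₀ ∷ c₁ ∷ [] , tt ⟩
  separator = ⟨ c₂ ∷ c₀ ∷ c₁ ∷ c₂ ∷ c₀ ∷ c₁ ∷ c₂ ∷ c₁ ∷ c₀ ∷ c₂ ∷ [] , tt ⟩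

  rotation-moves : ∀ p → (p ≡ pA ⊎ p ≡ pB) ⊎ σpos c₀ (σpos c₁ p) ≢ p
  rotation-moves pA = inj₁ (inj₁ refl)
  rotation-moves pB = inj₁ (inj₂ refl)
  rotation-moves pX = inj₂ (λ ())
  rotation-moves pY = inj₂ (λ ())
  rotation-moves pZ = inj₂ (λ ())
  rotation-moves pZ′ = inj₂ (λ ())
  rotation-moves (pout k) with prev k in prev-k
  ... | just j = inj₂ (λ { refl → prev-irreflexive k prev-k })
  ... | nothing = inj₂ (λ ())
  rotation-moves (pin k) with next k in next-k
  ... | just j = inj₂ (λ { refl → next-irreflexive k next-k })
  ... | nothing = inj₂ (λ ())

  -- B ↦ Y ↦ Z′ ↦ out 0 ↦ in 0 ↦ (out 1 or X) ↦ … never returns to B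
  separator-moves-B : ∀ δ → proj₂ (act separator (δ , pB)) ≢ pB
  separator-moves-B δ with next {m} zero in next-0
  ... | nothing = λ ()
  ... | just j rewrite next⇒prev zero next-0 = λ ()

  stab-fixed⇒A : ∀ v → (∀ h → Stab h → act h v ≡ v) → proj₂ v ≡ pA
  stab-fixed⇒A (δ , p) fixed with rotation-moves p
  ... | inj₁ (inj₁ p≡A) = p≡A
  ... | inj₁ (inj₂ refl) = ⊥-elim (separator-moves-B δ (cong proj₂ (fixed separator refl)))
  ... | inj₂ moves = ⊥-elim (moves (cong proj₂ (fixed rotation refl)))

  label : G → K
  label x = proj₁ (act x v₀)

  normalizer⇒A : ∀ g → Normalizer Stab g → act g v₀ ≡ (label g , pA)
  normalizer⇒A g g∈N = cong (label g ,_) (stab-fixed⇒A (act g v₀) (normalizer⇒fixed g g∈N))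

  label-· : ∀ x y → Normalizer Stab y → label (x · y) ≡ label x ⊙ label y
  label-· x y y∈N = cong proj₁ (begin
    act (x · y) v₀                     ≡⟨ act-· x y v₀ ⟩
    act x (act y v₀)                   ≡⟨ cong (act x) (trans (normalizer⇒A y y∈N) (sym (shift-v₀ (label y)))) ⟩
    act x (shift (label y) v₀)         ≡⟨ shift-equivariant (label y) x v₀ ⟩
    shift (label y) (act x v₀)         ∎)
    where open ≡-Reasoning

  label-coset⇒ : ∀ x y → Stab (x ⁻¹ · y) → label x ≡ label y
  label-coset⇒ x y x⁻¹y∈ = cong proj₁ (same-coset⇒ x y x⁻¹y∈)

  label-coset⇐ : ∀ x y → Normalizer Stab x → Normalizer Stab y → label x ≡ label y → Stab (x ⁻¹ · y)
  label-coset⇐ x y x∈N y∈N same = same-coset⇐ x y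
    (trans (normalizer⇒A x x∈N) (trans (cong (_, pA) same) (sym (normalizer⇒A y y∈N))))

  label-onto : ∀ δ → Normalizer Stab (t (δ , pA)) × label (t (δ , pA)) ≡ δ
  label-onto δ = at-A⇒normalizer (t (δ , pA)) δ (reaches (spanning (δ , pA))) ,
                 cong proj₁ (reaches (spanning (δ , pA)))

  positions : List (Pos K)
  positions = pA ∷ pB ∷ pX ∷ pY ∷ pZ ∷ pZ′ ∷ map pout (allFin (suc m)) ++ map pin (allFin (suc m))

  ∈-positions : ∀ p → p ∈ positions
  ∈-positions pA = here refl
  ∈-positions pB = there (here refl)
  ∈-positions pX = there (there (here refl))
  ∈-positions pY = there (there (there (here refl)))
  ∈-positions pZ = there (there (there (there (here refl))))
  ∈-positions pZ′ = there (there (there (there (there (here refl)))))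
  ∈-positions (pout k) = there (there (there (there (there (there
    (∈-++⁺ˡ (∈-map⁺ pout (∈-allFin k))))))))
  ∈-positions (pin k) = there (there (there (there (there (there
    (∈-++⁺ʳ (map pout (allFin (suc m))) (∈-map⁺ pin (∈-allFin k))))))))

  stab-finite-index : FiniteIndex Stab
  stab-finite-index =
    finite-index t (λ u → reaches (spanning u)) (cartesianProduct (allFin (suc m)) positions)
      (λ { (δ , p) → ∈-cartesianProduct⁺ (∈-allFin δ) (∈-positions p) })

module Transport (Γ : Group 0ℓ 0ℓ) {A : Set} (bij : Inverse (setoid A) (Group.setoid Γ)) where

  open Group Γ using (∙-congˡ; ∙-congʳ)
    renaming (_∙_ to _∘_; ε to ε′; _⁻¹ to _⁻¹′; assoc to ∘-assoc; identityˡ to ∘-identityˡ;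
              identityʳ to ∘-identityʳ; inverseˡ to ∘-inverseˡ; inverseʳ to ∘-inverseʳ;
              sym to ≈-sym; trans to ≈-trans)
  open Inverse bij using (to; from; from-cong; strictlyInverseˡ; strictlyInverseʳ)

  _⊙_ : A → A → A
  a ⊙ b = from (to a ∘ to b)

  one : A
  one = from ε′

  inv : A → A
  inv a = from (to a ⁻¹′)

  ⊙-assoc : ∀ a b c → (a ⊙ b) ⊙ c ≡ a ⊙ (b ⊙ c)
  ⊙-assoc a b c = from-cong (≈-trans (∙-congʳ (strictlyInverseˡ _))
    (≈-trans (∘-assoc (to a) (to b) (to c)) (∙-congˡ (≈-sym (strictlyInverseˡ _)))))

  ⊙-identityˡ : ∀ a → one ⊙ a ≡ a
  ⊙-identityˡ a = trans (from-cong (≈-trans (∙-congʳ (strictlyInverseˡ ε′)) (∘-identityˡ (to a))))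
                        (strictlyInverseʳ a)

  ⊙-identityʳ : ∀ a → a ⊙ one ≡ a
  ⊙-identityʳ a = trans (from-cong (≈-trans (∙-congˡ (strictlyInverseˡ ε′)) (∘-identityʳ (to a))))
                        (strictlyInverseʳ a)

  ⊙-inverseˡ : ∀ a → inv a ⊙ a ≡ one
  ⊙-inverseˡ a = from-cong (≈-trans (∙-congʳ (strictlyInverseˡ _)) (∘-inverseˡ (to a)))

  ⊙-inverseʳ : ∀ a → a ⊙ inv a ≡ one
  ⊙-inverseʳ a = from-cong (≈-trans (∙-congˡ (strictlyInverseˡ _)) (∘-inverseʳ (to a)))

  isGroup : IsGroup _≡_ _⊙_ one inv
  isGroup = record
    { isMonoid = record
      { isSemigroup = record
        { isMagma = record { isEquivalence = isEquivalence ; ∙-cong = cong₂ _⊙_ }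
        ; assoc = ⊙-assoc }
      ; identity = ⊙-identityˡ , ⊙-identityʳ }
    ; inverse = ⊙-inverseˡ , ⊙-inverseʳ
    ; ⁻¹-cong = cong inv }

module Realisation (Γ : Group 0ℓ 0ℓ) (m : ℕ) (bij : Inverse (setoid (Fin (suc m))) (Group.setoid Γ)) where

  open Transport Γ bij using (isGroup)
  open Gadget m isGroup
  open Group Γ using (_≈_; _∙_; reflexive) renaming (trans to ≈-trans)
  open Inverse bij using (to; from; from-cong; strictlyInverseˡ; strictlyInverseʳ)

  quotient-iso : QuotientIso Stab Γ
  quotient-iso = (λ x → to (label x)) , constant , injective , homomorphic , surjective
    where
      constant : ∀ x y → Normalizer Stab x → Normalizer Stab y →
                 Stab (x ⁻¹ · y) → to (label x) ≈ to (label y)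
      constant x y _ _ x⁻¹y∈ = reflexive (cong to (label-coset⇒ x y x⁻¹y∈))

      injective : ∀ x y → Normalizer Stab x → Normalizer Stab y →
                  to (label x) ≈ to (label y) → Stab (x ⁻¹ · y)
      injective x y x∈N y∈N same = label-coset⇐ x y x∈N y∈N
        (trans (sym (strictlyInverseʳ (label x))) (trans (from-cong same) (strictlyInverseʳ (label y))))

      homomorphic : ∀ x y → Normalizer Stab x → Normalizer Stab y →
                    to (label (x · y)) ≈ to (label x) ∙ to (label y)
      homomorphic x y _ y∈N = ≈-trans (reflexive (cong to (label-· x y y∈N))) (strictlyInverseˡ _)

      surjective : ∀ γ → Σ G λ x → Normalizer Stab x × to (label x) ≈ γ
      surjective γ = t (from γ , pA) , proj₁ (label-onto (from γ)) ,
                     ≈-trans (reflexive (cong to (proj₂ (label-onto (from γ))))) (strictlyInverseˡ γ)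

  realisation : Σ (G → Set) λ H → IsSubgroup H × FiniteIndex H × IsFree H × QuotientIso H Γ
  realisation = Stab , stab-subgroup , stab-finite-index , stab-free , quotient-iso

-- Proposition 3.2: Z₂ * Z₂ * Z₂ is freely telescopic.  A finite group Γ is
-- non-empty (it contains ε), so it is in bijection with some Fin (suc m).
proposition3p2 : Z₂*Z₂*Z₂-FreelyTelescopic
proposition3p2 Γ (zero , bij) with Inverse.from bij (Group.ε Γ)
... | ()
proposition3p2 Γ (suc m , bij) = Realisation.realisation Γ m bij
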